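{- For every nonnegative integer $n$, \[ \frac{1}{(q)_\infty}\sum_{k=0}^\infty\frac{q^{k^2}}{(q)_k(q)_{n-k}}=\frac{1}{(q)_n}\sum_{k=0}^\infty\frac{q^{k^2}}{(q)_k(q)_{n+k}}, \qquad \frac{1}{(q)_\infty}\sum_{k=0}^\infty\frac{q^{k^2+k}}{(q)_k(q)_{n-k}}=\frac{1}{(q)_n}\sum_{k=0}^\infty\frac{q^{k^2+k}}{(q)_k(q)_{n+k+1}}. \]
   Context: Throughout, $q$ is a complex number with $0<|q|<1$. For an integer $N\ge0$, $(q)_N=(1-q)(1-q^2)\cdots(1-q^N)$ (with $(q)_0=1$), by convention $1/(q)_N=0$ for $N<0$, and $(q)_\infty=\prod_{i\ge1}(1-q^i)$. -}

module Defs where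

open import Data.Nat as ℕ using (ℕ; zero; suc; _≤?_; _∸_; _≟_)
open import Data.Integer using (ℤ; 0ℤ; 1ℤ; _+_; _*_; -_)
open import Data.List using (List; []; _∷_; _++_)
open import Relation.Nullary using (yes; no)
open import Relation.Binary.PropositionalEquality using (_≡_)

FPS : Set
FPS = ℕ → ℤ

sumTo : ℕ → (ℕ → ℤ) → ℤ
sumTo zero h = h 0
sumTo (suc m) h = sumTo m h + h (suc m)

zeroS : FPS
zeroS _ = 0ℤ

_⊕_ : FPS → FPS → FPS
(f ⊕ g) m = f m + g m

_⊖_ : FPS → FPS → FPS
(f ⊖ g) m = f m + - g m

_⊗_ : FPS → FPS → FPS
(f ⊗ g) m = sumTo m (λ i → f i * g (m ∸ i))

infixl 7 _⊗_
infixl 6 _⊕_ _⊖_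

mono : ℕ → FPS
mono e m with m ≟ e
... | yes _ = 1ℤ
... | no _ = 0ℤ

oneS : FPS
oneS = mono 0

poch : ℕ → FPS
poch zero = oneS
poch (suc N) = poch N ⊗ (oneS ⊖ mono (suc N))

-- (q)_∞ : its q^m coefficient equals that of (q)_m (factors 1-q^i, i>m, do not affect it)
pochInf : FPS
pochInf m = poch m m

-- reciprocal of a series with constant term 1:
-- b_0 = 1, b_m = - Σ_{j=1}^{m} a_j b_{m-j}
nth : List ℤ → ℕ → ℤ
nth [] _ = 0ℤ
nth (x ∷ xs) zero = x
nth (x ∷ xs) (suc i) = nth xs i

invList : FPS → ℕ → List ℤ
invList a zero = 1ℤ ∷ []
invList a (suc m) =
  let bs = invList a m in
  bs ++ ((- sumTo m (λ i → a (suc i) * nth bs (m ∸ i))) ∷ [])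

inv : FPS → FPS
inv a m = nth (invList a m) m

-- 1/(q)_N with the convention 1/(q)_N = 0 for N < 0; here N = n - k (integers)
invPochSub : ℕ → ℕ → FPS
invPochSub n k with k ≤? n
... | yes _ = inv (poch (n ∸ k))
... | no _ = zeroS

-- Σ_{k≥0} F k, for families where F k is divisible by q^k (true here: each term
-- carries a factor q^{k²} or q^{k²+k}), so the q^m coefficient only gets
-- contributions from k ≤ m.
sumSeries : (ℕ → FPS) → FPS
sumSeries F m = sumTo m (λ k → F k m)

_≐_ : FPS → FPS → Set
f ≐ g = ∀ m → f m ≡ g m

{-# OPTIONS --safe #-}
-- Write each side of both identities as a pair (X n, X′ n), X for the exponent k² and X′ for
-- k² + k.  Using only 1/(q)_k = (1 - q^(k+1))/(q)_(k+1), termwise, one checks that the left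
-- pair and the right pair satisfy the same backward recurrence
--   X n = (1 - q^(n+1)) X (n+1) - q^(n+1) X′ n,     X′ n = X′ (n+1) - q^(n+1) X (n+1),
-- so agreement modulo q^M at index n + 1 propagates to index n.  At index N both sides agree
-- modulo q^(N+1) with Σ_k q^(e k)/((q)_k (q)_∞²): there 1/(q)_(N-k) and 1/(q)_(N+k) may be
-- replaced by 1/(q)_∞, as the factor q^(e k), e k ≥ k, hides the error.  Starting from
-- N = n + m and descending to n identifies the coefficients of q^m.
module Submission where

open import Defs
open import Data.Nat using (ℕ; zero; suc; _+_; _*_; _∸_; _≤_; _<_; _≤′_; z≤n; s≤s; ≤′-refl; ≤′-step; _≤?_)
import Data.Nat.Properties as ℕ
open import Data.Nat.Tactic.RingSolver using () renaming (solve to ℕ-solve)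
open import Data.Integer as Int using (ℤ; 0ℤ; 1ℤ) renaming (_+_ to _+ℤ_; _*_ to _*ℤ_; -_ to -ℤ_)
import Data.Integer.Properties as ℤ
open import Data.Integer.Tactic.RingSolver using (solve-∀)
open import Data.List using (List; []; _∷_; _++_; length)
open import Data.List.Properties using (length-++)
open import Data.Maybe using (Maybe; just; nothing)
open import Data.Product using (_×_; _,_; proj₁; proj₂)
open import Data.Sum using (_⊎_; inj₁; inj₂)
open import Data.Empty using (⊥-elim)
open import Level using (0ℓ)
open import Relation.Nullary using (Dec; yes; no)
open import Relation.Binary.PropositionalEquality hiding (J)
open import Relation.Binary.Bundles using (Setoid)
import Relation.Binary.Reasoning.Setoid as SetoidReasoning
open import Algebra.Bundles using (CommutativeRing)
open import Algebra.Solver.Ring.AlmostCommutativeRing using (_-Raw-AlmostCommutative⟶_; fromCommutativeRing)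
import Algebra.Solver.Ring

sumTo-cong-≤ : ∀ m {h g : ℕ → ℤ} → (∀ i → i ≤ m → h i ≡ g i) → sumTo m h ≡ sumTo m g
sumTo-cong-≤ zero    h≡g = h≡g 0 z≤n
sumTo-cong-≤ (suc m) h≡g =
  cong₂ _+ℤ_ (sumTo-cong-≤ m (λ i i≤m → h≡g i (ℕ.m≤n⇒m≤1+n i≤m))) (h≡g (suc m) ℕ.≤-refl)

sumTo-cong : ∀ m {h g : ℕ → ℤ} → (∀ i → h i ≡ g i) → sumTo m h ≡ sumTo m g
sumTo-cong m h≡g = sumTo-cong-≤ m (λ i _ → h≡g i)

sumTo-zero : ∀ m {h : ℕ → ℤ} → (∀ i → i ≤ m → h i ≡ 0ℤ) → sumTo m h ≡ 0ℤ
sumTo-zero m h≡0 = trans (sumTo-cong-≤ m h≡0) (sumTo-const0 m)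
  where
  sumTo-const0 : ∀ m → sumTo m (λ _ → 0ℤ) ≡ 0ℤ
  sumTo-const0 zero    = refl
  sumTo-const0 (suc m) = cong (_+ℤ 0ℤ) (sumTo-const0 m)

sumTo-+ : ∀ m (h g : ℕ → ℤ) → sumTo m (λ i → h i +ℤ g i) ≡ sumTo m h +ℤ sumTo m g
sumTo-+ zero    h g = refl
sumTo-+ (suc m) h g = trans (cong (_+ℤ (h (suc m) +ℤ g (suc m))) (sumTo-+ m h g))
                            (interchange (sumTo m h) (sumTo m g) (h (suc m)) (g (suc m)))
  where
  interchange : ∀ a b c d → a +ℤ b +ℤ (c +ℤ d) ≡ a +ℤ c +ℤ (b +ℤ d)
  interchange = solve-∀

sumTo-neg : ∀ m (h : ℕ → ℤ) → sumTo m (λ i → -ℤ h i) ≡ -ℤ sumTo m h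
sumTo-neg zero    h = refl
sumTo-neg (suc m) h = trans (cong (_+ℤ -ℤ h (suc m)) (sumTo-neg m h))
                            (sym (ℤ.neg-distrib-+ (sumTo m h) (h (suc m))))

*-sumTo : ∀ m c (h : ℕ → ℤ) → c *ℤ sumTo m h ≡ sumTo m (λ i → c *ℤ h i)
*-sumTo zero    c h = refl
*-sumTo (suc m) c h = trans (ℤ.*-distribˡ-+ c (sumTo m h) (h (suc m)))
                            (cong (_+ℤ c *ℤ h (suc m)) (*-sumTo m c h))

sumTo-* : ∀ m c (h : ℕ → ℤ) → sumTo m h *ℤ c ≡ sumTo m (λ i → h i *ℤ c)
sumTo-* m c h = trans (ℤ.*-comm (sumTo m h) c)
                      (trans (*-sumTo m c h) (sumTo-cong m (λ i → ℤ.*-comm c (h i))))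

sumTo-suc-head : ∀ m (h : ℕ → ℤ) → sumTo (suc m) h ≡ h 0 +ℤ sumTo m (λ i → h (suc i))
sumTo-suc-head zero    h = refl
sumTo-suc-head (suc m) h = trans (cong (_+ℤ h (suc (suc m))) (sumTo-suc-head m h))
                                 (ℤ.+-assoc (h 0) _ _)

sumTo-reverse : ∀ m (h : ℕ → ℤ) → sumTo m h ≡ sumTo m (λ i → h (m ∸ i))
sumTo-reverse zero    h = refl
sumTo-reverse (suc m) h = begin
  sumTo m h +ℤ h (suc m)                        ≡⟨ cong (_+ℤ h (suc m)) (sumTo-reverse m h) ⟩
  sumTo m (λ i → h (m ∸ i)) +ℤ h (suc m)        ≡⟨ ℤ.+-comm _ (h (suc m)) ⟩
  h (suc m) +ℤ sumTo m (λ i → h (m ∸ i))        ≡⟨ sym (sumTo-suc-head m (λ i → h (suc m ∸ i))) ⟩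
  sumTo (suc m) (λ i → h (suc m ∸ i))           ∎
  where open ≡-Reasoning

sumTo-pad : ∀ {m} m′ {h : ℕ → ℤ} → m ≤ m′ → (∀ i → m < i → h i ≡ 0ℤ) → sumTo m′ h ≡ sumTo m h
sumTo-pad zero     z≤n _ = refl
sumTo-pad (suc m′) m≤1+m′ h≡0 with ℕ.m≤n⇒m<n∨m≡n m≤1+m′
... | inj₂ refl        = refl
... | inj₁ (s≤s m≤m′) =
  trans (cong₂ _+ℤ_ (sumTo-pad m′ m≤m′ h≡0) (h≡0 (suc m′) (s≤s m≤m′))) (ℤ.+-identityʳ _)

sumTo-swap : ∀ m n (F : ℕ → ℕ → ℤ) →
             sumTo m (λ i → sumTo n (F i)) ≡ sumTo n (λ j → sumTo m (λ i → F i j))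
sumTo-swap zero    n F = refl
sumTo-swap (suc m) n F = trans (cong (_+ℤ sumTo n (F (suc m))) (sumTo-swap m n F))
                               (sym (sumTo-+ n (λ j → sumTo m (λ i → F i j)) (F (suc m))))

sumTo-triangle : ∀ m (F : ℕ → ℕ → ℤ) →
                 sumTo m (λ i → sumTo i (F i)) ≡ sumTo m (λ j → sumTo (m ∸ j) (λ l → F (j + l) j))
sumTo-triangle zero    F = refl
sumTo-triangle (suc m) F = begin
  sumTo m (λ i → sumTo i (F i)) +ℤ sumTo (suc m) (F (suc m))
    ≡⟨ cong (_+ℤ sumTo (suc m) (F (suc m))) (sumTo-triangle m F) ⟩
  Columns m +ℤ (sumTo m (F (suc m)) +ℤ F (suc m) (suc m))
    ≡⟨ sym (ℤ.+-assoc (Columns m) _ _) ⟩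
  Columns m +ℤ sumTo m (F (suc m)) +ℤ F (suc m) (suc m)
    ≡⟨ cong (_+ℤ F (suc m) (suc m)) (sym (sumTo-+ m _ _)) ⟩
  sumTo m (λ j → Column j (m ∸ j) +ℤ F (suc m) j) +ℤ F (suc m) (suc m)
    ≡⟨ cong₂ _+ℤ_ (sumTo-cong-≤ m extend-column) (cong (λ i → F i (suc m)) (sym (ℕ.+-identityʳ (suc m)))) ⟩
  sumTo m (λ j → Column j (suc m ∸ j)) +ℤ Column (suc m) 0
    ≡⟨ cong (λ r → sumTo m (λ j → Column j (suc m ∸ j)) +ℤ Column (suc m) r) (sym (ℕ.n∸n≡0 m)) ⟩
  Columns (suc m)
    ∎
  where
  open ≡-Reasoning
  Column : ℕ → ℕ → ℤ
  Column j r = sumTo r (λ l → F (j + l) j)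
  Columns : ℕ → ℤ
  Columns m = sumTo m (λ j → Column j (m ∸ j))
  extend-column : ∀ j → j ≤ m → Column j (m ∸ j) +ℤ F (suc m) j ≡ Column j (suc m ∸ j)
  extend-column j j≤m rewrite ℕ.+-∸-assoc 1 j≤m =
    cong (λ i → Column j (m ∸ j) +ℤ F i j)
         (trans (cong suc (sym (ℕ.m+[n∸m]≡n j≤m))) (sym (ℕ.+-suc j (m ∸ j))))

-- The ring of formal power series

≐-refl : ∀ {f} → f ≐ f
≐-refl m = refl

≐-sym : ∀ {f g} → f ≐ g → g ≐ f
≐-sym f≐g m = sym (f≐g m)

≐-trans : ∀ {f g h} → f ≐ g → g ≐ h → f ≐ h
≐-trans f≐g g≐h m = trans (f≐g m) (g≐h m)

mono-diagonal : ∀ e → mono e e ≡ 1ℤ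
mono-diagonal e with e ℕ.≟ e
... | yes _  = refl
... | no e≢e = ⊥-elim (e≢e refl)

mono-off-diagonal : ∀ {e m} → m ≢ e → mono e m ≡ 0ℤ
mono-off-diagonal {e} {m} m≢e with m ℕ.≟ e
... | yes m≡e = ⊥-elim (m≢e m≡e)
... | no _    = refl

sumTo-mono-*-vanish : ∀ m {e} (h : ℕ → ℤ) → m < e → sumTo m (λ i → mono e i *ℤ h i) ≡ 0ℤ
sumTo-mono-*-vanish m h m<e = sumTo-zero m (λ i i≤m →
  trans (cong (_*ℤ h i) (mono-off-diagonal (ℕ.<⇒≢ (ℕ.≤-<-trans i≤m m<e)))) (ℤ.*-zeroˡ (h i)))

sumTo-mono-* : ∀ m {e} (h : ℕ → ℤ) → e ≤ m → sumTo m (λ i → mono e i *ℤ h i) ≡ h e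
sumTo-mono-* zero    h z≤n = ℤ.*-identityˡ (h 0)
sumTo-mono-* (suc m) h e≤1+m with ℕ.m≤n⇒m<n∨m≡n e≤1+m
... | inj₁ e<1+m =
  trans (cong₂ _+ℤ_ (sumTo-mono-* m h (ℕ.≤-pred e<1+m))
                    (trans (cong (_*ℤ h (suc m)) (mono-off-diagonal (ℕ.>⇒≢ e<1+m))) (ℤ.*-zeroˡ (h (suc m)))))
        (ℤ.+-identityʳ _)
... | inj₂ refl =
  trans (cong₂ _+ℤ_ (sumTo-mono-*-vanish m h ℕ.≤-refl) (cong (_*ℤ h (suc m)) (mono-diagonal (suc m))))
        (trans (ℤ.+-identityˡ _) (ℤ.*-identityˡ _))

mono-⊗-≥ : ∀ e f {m} → e ≤ m → (mono e ⊗ f) m ≡ f (m ∸ e)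
mono-⊗-≥ e f {m} = sumTo-mono-* m (λ i → f (m ∸ i))

mono-⊗-< : ∀ e f {m} → m < e → (mono e ⊗ f) m ≡ 0ℤ
mono-⊗-< e f {m} = sumTo-mono-*-vanish m (λ i → f (m ∸ i))

⊗-cong : ∀ {f f′ g g′} → f ≐ f′ → g ≐ g′ → (f ⊗ g) ≐ (f′ ⊗ g′)
⊗-cong f≐f′ g≐g′ m = sumTo-cong m (λ i → cong₂ _*ℤ_ (f≐f′ i) (g≐g′ (m ∸ i)))

⊗-congˡ : ∀ f {g g′} → g ≐ g′ → (f ⊗ g) ≐ (f ⊗ g′)
⊗-congˡ f = ⊗-cong (≐-refl {f})

⊗-congʳ : ∀ g {f f′} → f ≐ f′ → (f ⊗ g) ≐ (f′ ⊗ g)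
⊗-congʳ g f≐f′ = ⊗-cong f≐f′ (≐-refl {g})

⊗-comm : ∀ f g → (f ⊗ g) ≐ (g ⊗ f)
⊗-comm f g m = trans (sumTo-reverse m _) (sumTo-cong-≤ m (λ i i≤m →
  trans (cong (λ j → f (m ∸ i) *ℤ g j) (ℕ.m∸[m∸n]≡n i≤m)) (ℤ.*-comm (f (m ∸ i)) (g i))))

⊗-assoc : ∀ f g h → ((f ⊗ g) ⊗ h) ≐ (f ⊗ (g ⊗ h))
⊗-assoc f g h m = begin
  sumTo m (λ i → sumTo i (λ j → f j *ℤ g (i ∸ j)) *ℤ h (m ∸ i))
    ≡⟨ sumTo-cong m (λ i → sumTo-* i (h (m ∸ i)) (λ j → f j *ℤ g (i ∸ j))) ⟩
  sumTo m (λ i → sumTo i (λ j → f j *ℤ g (i ∸ j) *ℤ h (m ∸ i)))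
    ≡⟨ sumTo-triangle m (λ i j → f j *ℤ g (i ∸ j) *ℤ h (m ∸ i)) ⟩
  sumTo m (λ j → sumTo (m ∸ j) (λ l → f j *ℤ g (j + l ∸ j) *ℤ h (m ∸ (j + l))))
    ≡⟨ sumTo-cong m (λ j → sumTo-cong (m ∸ j) (λ l → reindex j l)) ⟩
  sumTo m (λ j → sumTo (m ∸ j) (λ l → f j *ℤ (g l *ℤ h (m ∸ j ∸ l))))
    ≡⟨ sumTo-cong m (λ j → sym (*-sumTo (m ∸ j) (f j) _)) ⟩
  sumTo m (λ j → f j *ℤ sumTo (m ∸ j) (λ l → g l *ℤ h (m ∸ j ∸ l)))
    ∎
  where
  open ≡-Reasoning
  reindex : ∀ j l → f j *ℤ g (j + l ∸ j) *ℤ h (m ∸ (j + l)) ≡ f j *ℤ (g l *ℤ h (m ∸ j ∸ l))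
  reindex j l = trans (cong₂ (λ a b → f j *ℤ g a *ℤ h b) (ℕ.m+n∸m≡n j l) (sym (ℕ.∸-+-assoc m j l)))
                      (ℤ.*-assoc (f j) (g l) (h (m ∸ j ∸ l)))

⊗-distribˡ-⊕ : ∀ f g h → (f ⊗ (g ⊕ h)) ≐ (f ⊗ g ⊕ f ⊗ h)
⊗-distribˡ-⊕ f g h m = trans (sumTo-cong m (λ i → ℤ.*-distribˡ-+ (f i) (g (m ∸ i)) (h (m ∸ i))))
                             (sumTo-+ m (λ i → f i *ℤ g (m ∸ i)) (λ i → f i *ℤ h (m ∸ i)))

⊗-distribʳ-⊕ : ∀ f g h → ((g ⊕ h) ⊗ f) ≐ (g ⊗ f ⊕ h ⊗ f)
⊗-distribʳ-⊕ f g h m = trans (sumTo-cong m (λ i → ℤ.*-distribʳ-+ (f (m ∸ i)) (g i) (h i)))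
                             (sumTo-+ m (λ i → g i *ℤ f (m ∸ i)) (λ i → h i *ℤ f (m ∸ i)))

⊗-identityˡ : ∀ f → (oneS ⊗ f) ≐ f
⊗-identityˡ f m = mono-⊗-≥ 0 f z≤n

⊗-identityʳ : ∀ f → (f ⊗ oneS) ≐ f
⊗-identityʳ f = ≐-trans (⊗-comm f oneS) (⊗-identityˡ f)

⊕-identityˡ : ∀ f → (zeroS ⊕ f) ≐ f
⊕-identityˡ f m = ℤ.+-identityˡ (f m)

⊗-zeroʳ : ∀ f → (f ⊗ zeroS) ≐ zeroS
⊗-zeroʳ f m = sumTo-zero m (λ i _ → ℤ.*-zeroʳ (f i))

negS : FPS → FPS
negS f m = -ℤ f m

⊕-cong : ∀ {f f′ g g′} → f ≐ f′ → g ≐ g′ → (f ⊕ g) ≐ (f′ ⊕ g′)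
⊕-cong f≐f′ g≐g′ m = cong₂ _+ℤ_ (f≐f′ m) (g≐g′ m)

⊖-cong : ∀ {f f′ g g′} → f ≐ f′ → g ≐ g′ → (f ⊖ g) ≐ (f′ ⊖ g′)
⊖-cong f≐f′ g≐g′ m = cong₂ (λ a b → a +ℤ -ℤ b) (f≐f′ m) (g≐g′ m)

⊖-congˡ : ∀ f {g g′} → g ≐ g′ → (f ⊖ g) ≐ (f ⊖ g′)
⊖-congˡ f = ⊖-cong (≐-refl {f})

⊖-congʳ : ∀ g {f f′} → f ≐ f′ → (f ⊖ g) ≐ (f′ ⊖ g)
⊖-congʳ g f≐f′ = ⊖-cong f≐f′ (≐-refl {g})

⊕-congˡ : ∀ f {g g′} → g ≐ g′ → (f ⊕ g) ≐ (f ⊕ g′)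
⊕-congˡ f = ⊕-cong (≐-refl {f})

FPS-commutativeRing : CommutativeRing 0ℓ 0ℓ
FPS-commutativeRing = record
  { Carrier = FPS ; _≈_ = _≐_ ; _+_ = _⊕_ ; _*_ = _⊗_ ; -_ = negS ; 0# = zeroS ; 1# = oneS
  ; isCommutativeRing = record
    { isRing = record
      { +-isAbelianGroup = record
        { isGroup = record
          { isMonoid = record
            { isSemigroup = record
              { isMagma = record
                { isEquivalence = record { refl = ≐-refl ; sym = ≐-sym ; trans = ≐-trans }
                ; ∙-cong = ⊕-cong }
              ; assoc = λ f g h m → ℤ.+-assoc (f m) (g m) (h m) }
            ; identity = (λ f m → ℤ.+-identityˡ (f m)) , (λ f m → ℤ.+-identityʳ (f m)) }
          ; inverse = (λ f m → ℤ.+-inverseˡ (f m)) , (λ f m → ℤ.+-inverseʳ (f m))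
          ; ⁻¹-cong = λ f≐g m → cong -ℤ_ (f≐g m) }
        ; comm = λ f g m → ℤ.+-comm (f m) (g m) }
      ; *-cong = ⊗-cong
      ; *-assoc = ⊗-assoc
      ; *-identity = ⊗-identityˡ , ⊗-identityʳ
      ; distrib = ⊗-distribˡ-⊕ , ⊗-distribʳ-⊕ }
    ; *-comm = ⊗-comm } }

-- The first clause makes the image of 1ℤ definitionally oneS, so that solver goals
-- written with oneS match the solver's normal forms.
fromℤ : ℤ → FPS
fromℤ (Int.+ 1) = oneS
fromℤ c         = λ m → c *ℤ oneS m

fromℤ-scales : ∀ c m → fromℤ c m ≡ c *ℤ oneS m
fromℤ-scales (Int.+ 1)           m = sym (ℤ.*-identityˡ (oneS m))
fromℤ-scales (Int.+ 0)           m = refl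
fromℤ-scales (Int.+ suc (suc n)) m = refl
fromℤ-scales Int.-[1+ n ]        m = refl

fromℤ-⊗ : ∀ c f → (fromℤ c ⊗ f) ≐ (λ m → c *ℤ f m)
fromℤ-⊗ c f m = begin
  sumTo m (λ i → fromℤ c i *ℤ f (m ∸ i))
    ≡⟨ sumTo-cong m (λ i → trans (cong (_*ℤ f (m ∸ i)) (fromℤ-scales c i))
                                 (ℤ.*-assoc c (oneS i) (f (m ∸ i)))) ⟩
  sumTo m (λ i → c *ℤ (oneS i *ℤ f (m ∸ i)))
    ≡⟨ sym (*-sumTo m c (λ i → oneS i *ℤ f (m ∸ i))) ⟩
  c *ℤ (oneS ⊗ f) m
    ≡⟨ cong (c *ℤ_) (⊗-identityˡ f m) ⟩
  c *ℤ f m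
    ∎
  where open ≡-Reasoning

fromℤ-homomorphism : CommutativeRing.rawRing ℤ.+-*-commutativeRing
                       -Raw-AlmostCommutative⟶ fromCommutativeRing FPS-commutativeRing
fromℤ-homomorphism = record
  { ⟦_⟧    = fromℤ
  ; +-homo = λ a b m → begin
      fromℤ (a +ℤ b) m                  ≡⟨ fromℤ-scales (a +ℤ b) m ⟩
      (a +ℤ b) *ℤ oneS m                ≡⟨ ℤ.*-distribʳ-+ (oneS m) a b ⟩
      a *ℤ oneS m +ℤ b *ℤ oneS m        ≡⟨ sym (cong₂ _+ℤ_ (fromℤ-scales a m) (fromℤ-scales b m)) ⟩
      fromℤ a m +ℤ fromℤ b m            ∎
  ; *-homo = λ a b m → begin
      fromℤ (a *ℤ b) m                  ≡⟨ fromℤ-scales (a *ℤ b) m ⟩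
      a *ℤ b *ℤ oneS m                  ≡⟨ ℤ.*-assoc a b (oneS m) ⟩
      a *ℤ (b *ℤ oneS m)                ≡⟨ cong (a *ℤ_) (sym (fromℤ-scales b m)) ⟩
      a *ℤ fromℤ b m                    ≡⟨ sym (fromℤ-⊗ a (fromℤ b) m) ⟩
      (fromℤ a ⊗ fromℤ b) m             ∎
  ; -‿homo = λ a m → begin
      fromℤ (-ℤ a) m                    ≡⟨ fromℤ-scales (-ℤ a) m ⟩
      -ℤ a *ℤ oneS m                    ≡⟨ sym (ℤ.neg-distribˡ-* a (oneS m)) ⟩
      -ℤ (a *ℤ oneS m)                  ≡⟨ cong -ℤ_ (sym (fromℤ-scales a m)) ⟩
      -ℤ fromℤ a m                      ∎
  ; 0-homo = λ m → refl
  ; 1-homo = λ m → refl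
  }
  where open ≡-Reasoning

fromℤ-≟ : ∀ a b → Maybe (fromℤ a ≐ fromℤ b)
fromℤ-≟ a b with a ℤ.≟ b
... | yes refl = just ≐-refl
... | no _     = nothing

module FPS-Solver = Algebra.Solver.Ring (CommutativeRing.rawRing ℤ.+-*-commutativeRing)
  (fromCommutativeRing FPS-commutativeRing) fromℤ-homomorphism fromℤ-≟

open FPS-Solver using (solve; _:=_; _:+_; _:*_; _:-_; con)

module ≐-Reasoning = SetoidReasoning (CommutativeRing.setoid FPS-commutativeRing)

⊗-distribˡ-⊖-⊗ : ∀ f x p y → (f ⊗ (x ⊖ p ⊗ y)) ≐ (f ⊗ x ⊖ p ⊗ (f ⊗ y))
⊗-distribˡ-⊖-⊗ = solve 4 (λ f x p y → f :* (x :- p :* y) := f :* x :- p :* (f :* y)) ≐-refl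

⊗-assoc₄ : ∀ p m i z → ((p ⊗ m) ⊗ i ⊗ z) ≐ (p ⊗ (m ⊗ i ⊗ z))
⊗-assoc₄ = solve 4 (λ p m i z → (p :* m) :* i :* z := p :* (m :* i :* z)) ≐-refl

invList-length : ∀ a m → length (invList a m) ≡ suc m
invList-length a zero    = refl
invList-length a (suc m) = trans (length-++ (invList a m))
                                 (trans (cong (_+ 1) (invList-length a m)) (ℕ.+-comm (suc m) 1))

nth-++ˡ : ∀ (xs ys : List ℤ) {i} → i < length xs → nth (xs ++ ys) i ≡ nth xs i
nth-++ˡ (x ∷ xs) ys {zero}  _         = refl
nth-++ˡ (x ∷ xs) ys {suc i} (s≤s i<n) = nth-++ˡ xs ys i<n

nth-++-last : ∀ (xs : List ℤ) y → nth (xs ++ y ∷ []) (length xs) ≡ y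
nth-++-last []       y = refl
nth-++-last (x ∷ xs) y = nth-++-last xs y

nth-invList : ∀ a {m i} → i ≤ m → nth (invList a m) i ≡ inv a i
nth-invList a {zero}  z≤n = refl
nth-invList a {suc m} {i} i≤1+m with ℕ.m≤n⇒m<n∨m≡n i≤1+m
... | inj₂ refl       = refl
... | inj₁ (s≤s i≤m) =
  trans (nth-++ˡ (invList a m) _ (subst (i <_) (sym (invList-length a m)) (s≤s i≤m)))
        (nth-invList a i≤m)

inv-suc : ∀ a m → inv a (suc m) ≡ -ℤ sumTo m (λ i → a (suc i) *ℤ inv a (m ∸ i))
inv-suc a m = begin
  nth (invList a m ++ b ∷ []) (suc m)
    ≡⟨ cong (nth (invList a m ++ b ∷ [])) (sym (invList-length a m)) ⟩
  nth (invList a m ++ b ∷ []) (length (invList a m))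
    ≡⟨ nth-++-last (invList a m) b ⟩
  b
    ≡⟨ cong -ℤ_ (sumTo-cong-≤ m (λ i _ → cong (a (suc i) *ℤ_) (nth-invList a (ℕ.m∸n≤m m i)))) ⟩
  -ℤ sumTo m (λ i → a (suc i) *ℤ inv a (m ∸ i))
    ∎
  where
  open ≡-Reasoning
  b : ℤ
  b = -ℤ sumTo m (λ i → a (suc i) *ℤ nth (invList a m) (m ∸ i))

⊗-inv : ∀ a → a 0 ≡ 1ℤ → (a ⊗ inv a) ≐ oneS
⊗-inv a a₀≡1 zero rewrite a₀≡1 = refl
⊗-inv a a₀≡1 (suc m) = begin
  sumTo (suc m) (λ i → a i *ℤ inv a (suc m ∸ i))   ≡⟨ sumTo-suc-head m _ ⟩
  a 0 *ℤ inv a (suc m) +ℤ S                        ≡⟨ cong₂ (λ x y → x *ℤ y +ℤ S) a₀≡1 (inv-suc a m) ⟩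
  1ℤ *ℤ -ℤ S +ℤ S                                  ≡⟨ cong (_+ℤ S) (ℤ.*-identityˡ (-ℤ S)) ⟩
  -ℤ S +ℤ S                                        ≡⟨ ℤ.+-inverseˡ S ⟩
  0ℤ                                               ≡⟨ sym (mono-off-diagonal {0} {suc m} (λ ())) ⟩
  oneS (suc m)                                     ∎
  where
  open ≡-Reasoning
  S : ℤ
  S = sumTo m (λ i → a (suc i) *ℤ inv a (m ∸ i))

inv-unique : ∀ a x → a 0 ≡ 1ℤ → (x ⊗ a) ≐ oneS → x ≐ inv a
inv-unique a x a₀≡1 x⊗a≐1 = begin
  x                  ≈⟨ ≐-sym (⊗-identityʳ x) ⟩
  x ⊗ oneS           ≈⟨ ⊗-congˡ x (≐-sym (⊗-inv a a₀≡1)) ⟩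
  x ⊗ (a ⊗ inv a)    ≈⟨ ≐-sym (⊗-assoc x a (inv a)) ⟩
  (x ⊗ a) ⊗ inv a    ≈⟨ ⊗-congʳ (inv a) x⊗a≐1 ⟩
  oneS ⊗ inv a       ≈⟨ ⊗-identityˡ (inv a) ⟩
  inv a              ∎
  where open ≐-Reasoning

-- Monomials, divisibility and congruences modulo q^M

mono-+ : ∀ a b → mono (a + b) ≐ (mono a ⊗ mono b)
mono-+ a b m with a ≤? m
... | no a≰m = trans (mono-off-diagonal {a + b} {m} (λ { refl → a≰m (ℕ.m≤m+n a b) }))
                     (sym (mono-⊗-< a (mono b) (ℕ.≰⇒> a≰m)))
... | yes a≤m = trans (shifted (m ℕ.≟ a + b)) (sym (mono-⊗-≥ a (mono b) a≤m))
  where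
  shifted : Dec (m ≡ a + b) → mono (a + b) m ≡ mono b (m ∸ a)
  shifted (yes refl) = trans (mono-diagonal (a + b))
                             (sym (trans (cong (mono b) (ℕ.m+n∸m≡n a b)) (mono-diagonal b)))
  shifted (no m≢a+b) = trans (mono-off-diagonal m≢a+b)
                             (sym (mono-off-diagonal (λ m∸a≡b → m≢a+b
                               (trans (sym (ℕ.m+[n∸m]≡n a≤m)) (cong (a +_) m∸a≡b)))))

≡⇒≐ : ∀ {f g} → f ≡ g → f ≐ g
≡⇒≐ refl = ≐-refl

mono-⊗-≡ : ∀ {a b c d} → a + b ≡ c + d → (mono a ⊗ mono b) ≐ (mono c ⊗ mono d)
mono-⊗-≡ {a} {b} {c} {d} a+b≡c+d =
  ≐-trans (≐-sym (mono-+ a b)) (≐-trans (≡⇒≐ (cong mono a+b≡c+d)) (mono-+ c d))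

q^_∣_ : ℕ → FPS → Set
q^ e ∣ f = ∀ m → m < e → f m ≡ 0ℤ

q^e∣mono : ∀ {d} e → d ≤ e → q^ d ∣ mono e
q^e∣mono e d≤e m m<d = mono-off-diagonal (ℕ.<⇒≢ (ℕ.<-≤-trans m<d d≤e))

q^e∣⊗ˡ : ∀ {e f} g → q^ e ∣ f → q^ e ∣ (f ⊗ g)
q^e∣⊗ˡ {f = f} g e∣f m m<e = sumTo-zero m (λ i i≤m →
  trans (cong (_*ℤ g (m ∸ i)) (e∣f i (ℕ.≤-<-trans i≤m m<e))) (ℤ.*-zeroˡ (g (m ∸ i))))

q^e∣⊗ʳ : ∀ {e g} f → q^ e ∣ g → q^ e ∣ (f ⊗ g)
q^e∣⊗ʳ {g = g} f e∣g m m<e = trans (⊗-comm f g m) (q^e∣⊗ˡ f e∣g m m<e)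

q^e∣⊖ : ∀ {e f g} → q^ e ∣ f → q^ e ∣ g → q^ e ∣ (f ⊖ g)
q^e∣⊖ e∣f e∣g m m<e rewrite e∣f m m<e | e∣g m m<e = refl

_≡_mod-q^_ : FPS → FPS → ℕ → Set
f ≡ g mod-q^ M = ∀ m → m < M → f m ≡ g m

≡mod-refl : ∀ {f M} → f ≡ f mod-q^ M
≡mod-refl _ _ = refl

≡mod-sym : ∀ {f g M} → f ≡ g mod-q^ M → g ≡ f mod-q^ M
≡mod-sym f≡g m m<M = sym (f≡g m m<M)

≡mod-trans : ∀ {f g h M} → f ≡ g mod-q^ M → g ≡ h mod-q^ M → f ≡ h mod-q^ M
≡mod-trans f≡g g≡h m m<M = trans (f≡g m m<M) (g≡h m m<M)

mod-q^-setoid : ℕ → Setoid 0ℓ 0ℓ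
mod-q^-setoid M = record
  { Carrier       = FPS
  ; _≈_           = λ f g → f ≡ g mod-q^ M
  ; isEquivalence = record { refl = ≡mod-refl ; sym = ≡mod-sym ; trans = ≡mod-trans }
  }

≐⇒≡mod : ∀ {f g} M → f ≐ g → f ≡ g mod-q^ M
≐⇒≡mod M f≐g m _ = f≐g m

≡mod-weaken : ∀ {f g M} M′ → M′ ≤ M → f ≡ g mod-q^ M → f ≡ g mod-q^ M′
≡mod-weaken M′ M′≤M f≡g m m<M′ = f≡g m (ℕ.<-≤-trans m<M′ M′≤M)

≡mod-⊗ : ∀ {f f′ g g′ M} → f ≡ f′ mod-q^ M → g ≡ g′ mod-q^ M → (f ⊗ g) ≡ (f′ ⊗ g′) mod-q^ M
≡mod-⊗ f≡f′ g≡g′ m m<M = sumTo-cong-≤ m (λ i i≤m →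
  cong₂ _*ℤ_ (f≡f′ i (ℕ.≤-<-trans i≤m m<M)) (g≡g′ (m ∸ i) (ℕ.≤-<-trans (ℕ.m∸n≤m m i) m<M)))

≡mod-⊖ : ∀ {f f′ g g′ M} → f ≡ f′ mod-q^ M → g ≡ g′ mod-q^ M → (f ⊖ g) ≡ (f′ ⊖ g′) mod-q^ M
≡mod-⊖ f≡f′ g≡g′ m m<M = cong₂ (λ a b → a +ℤ -ℤ b) (f≡f′ m m<M) (g≡g′ m m<M)

q^e∣-⊗-≡mod : ∀ {e M a b b′} → q^ e ∣ a → b ≡ b′ mod-q^ M → (a ⊗ b) ≡ (a ⊗ b′) mod-q^ (e + M)
q^e∣-⊗-≡mod {e} {M} {a} {b} {b′} e∣a b≡b′ m m<e+M = sumTo-cong-≤ m agree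
  where
  agree : ∀ i → i ≤ m → a i *ℤ b (m ∸ i) ≡ a i *ℤ b′ (m ∸ i)
  agree i i≤m with i ℕ.<? e
  ... | yes i<e rewrite e∣a i i<e = refl
  ... | no i≮e  = cong (a i *ℤ_) (b≡b′ (m ∸ i) (ℕ.+-cancelˡ-< e (m ∸ i) M (ℕ.≤-<-trans e+[m∸i]≤m m<e+M)))
    where
    e+[m∸i]≤m : e + (m ∸ i) ≤ m
    e+[m∸i]≤m = ℕ.≤-trans (ℕ.+-monoˡ-≤ (m ∸ i) (ℕ.≮⇒≥ i≮e)) (ℕ.≤-reflexive (ℕ.m+[n∸m]≡n i≤m))

inv-≡mod : ∀ a b {M} → a 0 ≡ 1ℤ → b 0 ≡ 1ℤ → a ≡ b mod-q^ M → inv a ≡ inv b mod-q^ M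
inv-≡mod a b {M} a₀≡1 b₀≡1 a≡b = begin
  inv a                    ≈⟨ ≐⇒≡mod M (≐-sym (⊗-identityʳ (inv a))) ⟩
  inv a ⊗ oneS             ≈⟨ ≐⇒≡mod M (⊗-congˡ (inv a) (≐-sym (⊗-inv b b₀≡1))) ⟩
  inv a ⊗ (b ⊗ inv b)      ≈⟨ ≡mod-⊗ (≡mod-refl {inv a}) (≡mod-⊗ (≡mod-sym a≡b) (≡mod-refl {inv b})) ⟩
  inv a ⊗ (a ⊗ inv b)      ≈⟨ ≐⇒≡mod M (≐-sym (⊗-assoc (inv a) a (inv b))) ⟩
  (inv a ⊗ a) ⊗ inv b      ≈⟨ ≐⇒≡mod M (⊗-congʳ (inv b) (≐-trans (⊗-comm (inv a) a) (⊗-inv a a₀≡1))) ⟩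
  oneS ⊗ inv b             ≈⟨ ≐⇒≡mod M (⊗-identityˡ (inv b)) ⟩
  inv b                    ∎
  where open SetoidReasoning (mod-q^-setoid M)

infix 25 1-q^_
1-q^_ : ℕ → FPS
1-q^ s = oneS ⊖ mono s

⊗-1-q^ : ∀ f s → (f ⊗ 1-q^ s) ≐ (f ⊖ mono s ⊗ f)
⊗-1-q^ f s = solve 2 (λ f x → f :* (con 1ℤ :- x) := f :- x :* f) ≐-refl f (mono s)

invPoch : ℕ → FPS
invPoch k = inv (poch k)

poch-constant : ∀ k → poch k 0 ≡ 1ℤ
poch-constant zero    = refl
poch-constant (suc k) rewrite poch-constant k = refl

⊗-invPoch : ∀ k → (poch k ⊗ invPoch k) ≐ oneS
⊗-invPoch k = ⊗-inv (poch k) (poch-constant k)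

invPoch-step : ∀ k → invPoch k ≐ (1-q^ suc k ⊗ invPoch (suc k))
invPoch-step k = ≐-sym (inv-unique (poch k) _ (poch-constant k) (begin
  (1-q^ suc k ⊗ invPoch (suc k)) ⊗ poch k  ≈⟨ regroup (1-q^ suc k) (invPoch (suc k)) (poch k) ⟩
  invPoch (suc k) ⊗ poch (suc k)            ≈⟨ ⊗-comm (invPoch (suc k)) (poch (suc k)) ⟩
  poch (suc k) ⊗ invPoch (suc k)            ≈⟨ ⊗-invPoch (suc k) ⟩
  oneS                                      ∎))
  where
  open ≐-Reasoning
  regroup : ∀ x y z → ((x ⊗ y) ⊗ z) ≐ (y ⊗ (z ⊗ x))
  regroup = solve 3 (λ x y z → (x :* y) :* z := y :* (z :* x)) ≐-refl

poch-stable : ∀ N {m} → m ≤ N → poch (suc N) m ≡ poch N m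
poch-stable N {m} m≤N = begin
  (poch N ⊗ 1-q^ suc N) m
    ≡⟨ ⊗-1-q^ (poch N) (suc N) m ⟩
  poch N m +ℤ -ℤ (mono (suc N) ⊗ poch N) m
    ≡⟨ cong (λ x → poch N m +ℤ -ℤ x) (mono-⊗-< (suc N) (poch N) (s≤s m≤N)) ⟩
  poch N m +ℤ 0ℤ
    ≡⟨ ℤ.+-identityʳ (poch N m) ⟩
  poch N m
    ∎
  where open ≡-Reasoning

poch≡pochInf : ∀ k → poch k ≡ pochInf mod-q^ suc k
poch≡pochInf zero    zero    _             = refl
poch≡pochInf zero    (suc m) (s≤s ())
poch≡pochInf (suc k) m       (s≤s m≤1+k) with ℕ.m≤n⇒m<n∨m≡n m≤1+k
... | inj₂ refl       = refl
... | inj₁ (s≤s m≤k) = trans (poch-stable k m≤k) (poch≡pochInf k m (s≤s m≤k))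

invPoch≡invPochInf : ∀ k → invPoch k ≡ inv pochInf mod-q^ suc k
invPoch≡invPochInf k = inv-≡mod (poch k) pochInf (poch-constant k) refl (poch≡pochInf k)

invPochSub-≤ : ∀ {n k} → k ≤ n → invPochSub n k ≐ invPoch (n ∸ k)
invPochSub-≤ {n} {k} k≤n with k ≤? n
... | yes _  = ≐-refl
... | no k≰n = ⊥-elim (k≰n k≤n)

invPochSub-> : ∀ {n k} → n < k → invPochSub n k ≐ zeroS
invPochSub-> {n} {k} n<k with k ≤? n
... | yes k≤n = ⊥-elim (ℕ.<⇒≱ n<k k≤n)
... | no _    = ≐-refl

invPochSub-suc : ∀ n k → invPochSub (suc n) (suc k) ≐ invPochSub n k
invPochSub-suc n k = by-cases (k ≤? n)
  where
  by-cases : Dec (k ≤ n) → invPochSub (suc n) (suc k) ≐ invPochSub n k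
  by-cases (yes k≤n) = ≐-trans (invPochSub-≤ (s≤s k≤n)) (≐-sym (invPochSub-≤ k≤n))
  by-cases (no k≰n)  = ≐-trans (invPochSub-> (s≤s (ℕ.≰⇒> k≰n))) (≐-sym (invPochSub-> (ℕ.≰⇒> k≰n)))

invPochSub-recurrence : ∀ n k → (mono k ⊗ invPochSub n k) ≐ ((mono k ⊖ mono (suc n)) ⊗ invPochSub (suc n) k)
invPochSub-recurrence n k = by-cases (k ≤? n)
  where
  RHS : FPS
  RHS = (mono k ⊖ mono (suc n)) ⊗ invPochSub (suc n) k
  by-cases : Dec (k ≤ n) → (mono k ⊗ invPochSub n k) ≐ RHS
  by-cases (yes k≤n) = begin
    mono k ⊗ invPochSub n k                     ≈⟨ ⊗-congˡ (mono k) (≐-trans (invPochSub-≤ k≤n) (invPoch-step (n ∸ k))) ⟩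
    mono k ⊗ (1-q^ suc (n ∸ k) ⊗ I)             ≈⟨ expand (mono k) (mono (suc (n ∸ k))) I ⟩
    (mono k ⊖ mono k ⊗ mono (suc (n ∸ k))) ⊗ I  ≈⟨ ⊗-cong (⊖-congˡ (mono k) q^k·q^[1+n∸k]≐q^[1+n]) (≐-sym J≐I) ⟩
    RHS                                         ∎
    where
    open ≐-Reasoning
    I : FPS
    I = invPoch (suc (n ∸ k))
    1+n∸k≡1+[n∸k] : suc n ∸ k ≡ suc (n ∸ k)
    1+n∸k≡1+[n∸k] = ℕ.+-∸-assoc 1 k≤n
    J≐I : invPochSub (suc n) k ≐ I
    J≐I = ≐-trans (invPochSub-≤ (ℕ.m≤n⇒m≤1+n k≤n)) (≡⇒≐ (cong invPoch 1+n∸k≡1+[n∸k]))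
    q^k·q^[1+n∸k]≐q^[1+n] : (mono k ⊗ mono (suc (n ∸ k))) ≐ mono (suc n)
    q^k·q^[1+n∸k]≐q^[1+n] = ≐-trans (≐-sym (mono-+ k (suc (n ∸ k))))
      (≡⇒≐ (cong mono (trans (cong (k +_) (sym 1+n∸k≡1+[n∸k])) (ℕ.m+[n∸m]≡n (ℕ.m≤n⇒m≤1+n k≤n)))))
    expand : ∀ x y z → (x ⊗ ((oneS ⊖ y) ⊗ z)) ≐ ((x ⊖ x ⊗ y) ⊗ z)
    expand = solve 3 (λ x y z → x :* ((con 1ℤ :- y) :* z) := (x :- x :* y) :* z) ≐-refl
  by-cases (no k≰n) = ≐-trans (⊗-congˡ (mono k) (invPochSub-> (ℕ.≰⇒> k≰n)))
                     (≐-trans (⊗-zeroʳ (mono k)) (≐-sym (RHS-vanishes (ℕ.m≤n⇒m<n∨m≡n (ℕ.≰⇒> k≰n)))))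
    where
    cancel : ∀ x y → ((x ⊖ x) ⊗ y) ≐ zeroS
    cancel = solve 2 (λ x y → (x :- x) :* y := con 0ℤ) ≐-refl
    RHS-vanishes : suc n < k ⊎ suc n ≡ k → RHS ≐ zeroS
    RHS-vanishes (inj₁ 1+n<k) = ≐-trans (⊗-congˡ (mono k ⊖ mono (suc n)) (invPochSub-> 1+n<k))
                                        (⊗-zeroʳ (mono k ⊖ mono (suc n)))
    RHS-vanishes (inj₂ refl)  = cancel (mono k) (invPochSub (suc n) k)

-- Series whose k-th term is divisible by q^k

n≤n*n : ∀ n → n ≤ n * n
n≤n*n zero      = z≤n
n≤n*n n@(suc _) = ℕ.m≤m*n n n

Summable : (ℕ → FPS) → Set
Summable F = ∀ k → q^ k ∣ F k

summable-term : ∀ (e : ℕ → ℕ) (x y : ℕ → FPS) → (∀ k → k ≤ e k) →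
                Summable (λ k → mono (e k) ⊗ x k ⊗ y k)
summable-term e x y k≤e k = q^e∣⊗ˡ (y k) (q^e∣⊗ˡ (x k) (q^e∣mono (e k) (k≤e k)))

sumSeries-cong : ∀ {F G} → (∀ k → F k ≐ G k) → sumSeries F ≐ sumSeries G
sumSeries-cong F≐G m = sumTo-cong m (λ k → F≐G k m)

sumSeries-⊖ : ∀ F G → sumSeries (λ k → F k ⊖ G k) ≐ (sumSeries F ⊖ sumSeries G)
sumSeries-⊖ F G m = trans (sumTo-+ m (λ k → F k m) (λ k → -ℤ G k m))
                          (cong (sumTo m (λ k → F k m) +ℤ_) (sumTo-neg m (λ k → G k m)))

sumSeries-truncate : ∀ {F} → Summable F → ∀ {m} N → m ≤ N → sumSeries F m ≡ sumTo N (λ k → F k m)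
sumSeries-truncate summable N m≤N = sym (sumTo-pad N m≤N (λ k m<k → summable k _ m<k))

⊗-sumSeries : ∀ a {F} → Summable F → (a ⊗ sumSeries F) ≐ sumSeries (λ k → a ⊗ F k)
⊗-sumSeries a {F} summable m = begin
  sumTo m (λ i → a i *ℤ sumSeries F (m ∸ i))
    ≡⟨ sumTo-cong-≤ m (λ i i≤m → cong (a i *ℤ_) (sumSeries-truncate summable m (ℕ.m∸n≤m m i))) ⟩
  sumTo m (λ i → a i *ℤ sumTo m (λ k → F k (m ∸ i)))
    ≡⟨ sumTo-cong m (λ i → *-sumTo m (a i) (λ k → F k (m ∸ i))) ⟩
  sumTo m (λ i → sumTo m (λ k → a i *ℤ F k (m ∸ i)))
    ≡⟨ sumTo-swap m m (λ i k → a i *ℤ F k (m ∸ i)) ⟩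
  sumTo m (λ k → sumTo m (λ i → a i *ℤ F k (m ∸ i)))
    ∎
  where open ≡-Reasoning

sumSeries-head : ∀ {F} → Summable F → sumSeries F ≐ (F 0 ⊕ sumSeries (λ k → F (suc k)))
sumSeries-head {F} summable zero    = sym (trans (cong (F 0 0 +ℤ_) (summable 1 0 (s≤s z≤n)))
                                                 (ℤ.+-identityʳ (F 0 0)))
sumSeries-head {F} summable (suc m) = trans (sumTo-suc-head m (λ k → F k (suc m)))
  (cong (F 0 (suc m) +ℤ_) (sym (trans (cong (sumTo m (λ k → F (suc k) (suc m)) +ℤ_) top-vanishes)
                                      (ℤ.+-identityʳ _))))
  where
  top-vanishes : F (suc (suc m)) (suc m) ≡ 0ℤ
  top-vanishes = summable (suc (suc m)) (suc m) ℕ.≤-refl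

sumSeries-≡mod : ∀ {F G M} → (∀ k → F k ≡ G k mod-q^ M) → sumSeries F ≡ sumSeries G mod-q^ M
sumSeries-≡mod F≡G m m<M = sumTo-cong m (λ k → F≡G k m m<M)

-- The backward recurrence

record BackwardRecurrence (X X′ : ℕ → FPS) : Set where
  field
    first  : ∀ n → X n ≐ (1-q^ suc n ⊗ X (suc n) ⊖ mono (suc n) ⊗ X′ n)
    second : ∀ n → X′ n ≐ (X′ (suc n) ⊖ mono (suc n) ⊗ X (suc n))

BackwardRecurrence-⊗ : ∀ f {X X′} → BackwardRecurrence X X′ →
                       BackwardRecurrence (λ n → f ⊗ X n) (λ n → f ⊗ X′ n)
BackwardRecurrence-⊗ f {X} {X′} rec = record
  { first  = λ n → ≐-trans (⊗-congˡ f (first n))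
                           (distribute f (1-q^ suc n) (X (suc n)) (mono (suc n)) (X′ n))
  ; second = λ n → ≐-trans (⊗-congˡ f (second n))
                           (⊗-distribˡ-⊖-⊗ f (X′ (suc n)) (mono (suc n)) (X (suc n)))
  }
  where
  open BackwardRecurrence rec
  distribute : ∀ f c x p y → (f ⊗ (c ⊗ x ⊖ p ⊗ y)) ≐ (c ⊗ (f ⊗ x) ⊖ p ⊗ (f ⊗ y))
  distribute = solve 5 (λ f c x p y → f :* (c :* x :- p :* y) := c :* (f :* x) :- p :* (f :* y)) ≐-refl

module _ {X X′ Y Y′ : ℕ → FPS} (recX : BackwardRecurrence X X′) (recY : BackwardRecurrence Y Y′) {M : ℕ}
  where
  private
    module RX = BackwardRecurrence recX
    module RY = BackwardRecurrence recY

  AgreeAt : ℕ → Set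
  AgreeAt n = (X n ≡ Y n mod-q^ M) × (X′ n ≡ Y′ n mod-q^ M)

  agreement-descends : ∀ {n} → AgreeAt (suc n) → AgreeAt n
  agreement-descends {n} (X≡Y , X′≡Y′) = X≡Y-at-n , X′≡Y′-at-n
    where
    open SetoidReasoning (mod-q^-setoid M)
    c P : FPS
    c = 1-q^ suc n
    P = mono (suc n)
    X′≡Y′-at-n : X′ n ≡ Y′ n mod-q^ M
    X′≡Y′-at-n = begin
      X′ n                        ≈⟨ ≐⇒≡mod M (RX.second n) ⟩
      X′ (suc n) ⊖ P ⊗ X (suc n)  ≈⟨ ≡mod-⊖ X′≡Y′ (≡mod-⊗ (≡mod-refl {P}) X≡Y) ⟩
      Y′ (suc n) ⊖ P ⊗ Y (suc n)  ≈⟨ ≐⇒≡mod M (≐-sym (RY.second n)) ⟩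
      Y′ n                        ∎
    X≡Y-at-n : X n ≡ Y n mod-q^ M
    X≡Y-at-n = begin
      X n                         ≈⟨ ≐⇒≡mod M (RX.first n) ⟩
      c ⊗ X (suc n) ⊖ P ⊗ X′ n    ≈⟨ ≡mod-⊖ (≡mod-⊗ (≡mod-refl {c}) X≡Y) (≡mod-⊗ (≡mod-refl {P}) X′≡Y′-at-n) ⟩
      c ⊗ Y (suc n) ⊖ P ⊗ Y′ n    ≈⟨ ≐⇒≡mod M (≐-sym (RY.first n)) ⟩
      Y n                         ∎

  agreement-descends* : ∀ {n N} → n ≤′ N → AgreeAt N → AgreeAt n
  agreement-descends* ≤′-refl        agree = agree
  agreement-descends* (≤′-step n≤′N) agree = agreement-descends* n≤′N (agreement-descends agree)

-- The left-hand side

lhsTerm lhsTerm′ : ℕ → ℕ → FPS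
lhsTerm  n k = mono (k * k) ⊗ invPoch k ⊗ invPochSub n k
lhsTerm′ n k = mono (k * k + k) ⊗ invPoch k ⊗ invPochSub n k

lhsSum lhsSum′ lhs lhs′ : ℕ → FPS
lhsSum  n = sumSeries (lhsTerm n)
lhsSum′ n = sumSeries (lhsTerm′ n)
lhs     n = inv pochInf ⊗ lhsSum n
lhs′    n = inv pochInf ⊗ lhsSum′ n

summable-lhsTerm : ∀ n → Summable (lhsTerm n)
summable-lhsTerm n = summable-term (λ k → k * k) invPoch (invPochSub n) n≤n*n

summable-lhsTerm′ : ∀ n → Summable (lhsTerm′ n)
summable-lhsTerm′ n = summable-term (λ k → k * k + k) invPoch (invPochSub n) (λ k → ℕ.m≤n+m k (k * k))

lhsTerm-difference-zero : ∀ n → (1-q^ suc n ⊗ lhsTerm (suc n) 0 ⊖ lhsTerm n 0) ≐ zeroS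
lhsTerm-difference-zero n = begin
  c ⊗ (oneS ⊗ invPoch 0 ⊗ J′) ⊖ oneS ⊗ invPoch 0 ⊗ J
    ≈⟨ factor c (invPoch 0) J′ J ⟩
  invPoch 0 ⊗ (c ⊗ J′ ⊖ oneS ⊗ J)
    ≈⟨ ⊗-congˡ (invPoch 0) (⊖-congˡ (c ⊗ J′) (invPochSub-recurrence n 0)) ⟩
  invPoch 0 ⊗ (c ⊗ J′ ⊖ c ⊗ J′)
    ≈⟨ cancel (invPoch 0) (c ⊗ J′) ⟩
  zeroS
    ∎
  where
  open ≐-Reasoning
  c J J′ : FPS
  c  = 1-q^ suc n
  J  = invPochSub n 0
  J′ = invPochSub (suc n) 0
  factor : ∀ c i j′ j → (c ⊗ (oneS ⊗ i ⊗ j′) ⊖ oneS ⊗ i ⊗ j) ≐ (i ⊗ (c ⊗ j′ ⊖ oneS ⊗ j))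
  factor = solve 4 (λ c i j′ j → c :* (con 1ℤ :* i :* j′) :- con 1ℤ :* i :* j
                               := i :* (c :* j′ :- con 1ℤ :* j)) ≐-refl
  cancel : ∀ i x → (i ⊗ (x ⊖ x)) ≐ zeroS
  cancel = solve 2 (λ i x → i :* (x :- x) := con 0ℤ) ≐-refl

mono-[1+j]² : ∀ j → mono (suc j * suc j) ≐ (mono (j * j + j) ⊗ mono (suc j))
mono-[1+j]² j = ≐-trans (≡⇒≐ (cong mono [1+j]²≡j²+j+[1+j])) (mono-+ (j * j + j) (suc j))
  where
  [1+j]²≡j²+j+[1+j] : suc j * suc j ≡ j * j + j + suc j
  [1+j]²≡j²+j+[1+j] = ℕ-solve (j ∷ [])

lhsTerm-difference-suc : ∀ n j → (1-q^ suc n ⊗ lhsTerm (suc n) (suc j) ⊖ lhsTerm n (suc j))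
                                 ≐ (mono (suc n) ⊗ lhsTerm′ n j)
lhsTerm-difference-suc n j = begin
  c ⊗ (mono (suc j * suc j) ⊗ I′ ⊗ J′) ⊖ mono (suc j * suc j) ⊗ I′ ⊗ J
    ≈⟨ ⊖-cong (⊗-congˡ c (⊗-congʳ J′ (⊗-congʳ I′ (mono-[1+j]² j))))
              (⊗-congʳ J (⊗-congʳ I′ (mono-[1+j]² j))) ⟩
  c ⊗ (M ⊗ Q ⊗ I′ ⊗ J′) ⊖ M ⊗ Q ⊗ I′ ⊗ J
    ≈⟨ regroup c M Q I′ J′ J ⟩
  c ⊗ (M ⊗ Q ⊗ I′ ⊗ J′) ⊖ M ⊗ I′ ⊗ (Q ⊗ J)
    ≈⟨ ⊖-congˡ (c ⊗ (M ⊗ Q ⊗ I′ ⊗ J′)) (⊗-congˡ (M ⊗ I′) (invPochSub-recurrence n (suc j))) ⟩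
  c ⊗ (M ⊗ Q ⊗ I′ ⊗ J′) ⊖ M ⊗ I′ ⊗ ((Q ⊖ P) ⊗ J′)
    ≈⟨ collect M Q I′ J′ P ⟩
  P ⊗ (M ⊗ (1-q^ suc j ⊗ I′) ⊗ J′)
    ≈⟨ ⊗-congˡ P (⊗-cong (⊗-congˡ M (≐-sym (invPoch-step j))) (invPochSub-suc n j)) ⟩
  P ⊗ lhsTerm′ n j
    ∎
  where
  open ≐-Reasoning
  c M Q P I′ J J′ : FPS
  c  = 1-q^ suc n
  M  = mono (j * j + j)
  Q  = mono (suc j)
  P  = mono (suc n)
  I′ = invPoch (suc j)
  J  = invPochSub n (suc j)
  J′ = invPochSub (suc n) (suc j)
  regroup : ∀ c m q i j′ j → (c ⊗ (m ⊗ q ⊗ i ⊗ j′) ⊖ m ⊗ q ⊗ i ⊗ j)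
                             ≐ (c ⊗ (m ⊗ q ⊗ i ⊗ j′) ⊖ m ⊗ i ⊗ (q ⊗ j))
  regroup = solve 6 (λ c m q i j′ j → c :* (m :* q :* i :* j′) :- m :* q :* i :* j
                                    := c :* (m :* q :* i :* j′) :- m :* i :* (q :* j)) ≐-refl
  collect : ∀ m q i j′ p → ((oneS ⊖ p) ⊗ (m ⊗ q ⊗ i ⊗ j′) ⊖ m ⊗ i ⊗ ((q ⊖ p) ⊗ j′))
                           ≐ (p ⊗ (m ⊗ ((oneS ⊖ q) ⊗ i) ⊗ j′))
  collect = solve 5 (λ m q i j′ p → (con 1ℤ :- p) :* (m :* q :* i :* j′) :- m :* i :* ((q :- p) :* j′)
                                  := p :* (m :* ((con 1ℤ :- q) :* i) :* j′)) ≐-refl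

lhsTerm′-step : ∀ n k → lhsTerm′ n k ≐ (lhsTerm′ (suc n) k ⊖ mono (suc n) ⊗ lhsTerm (suc n) k)
lhsTerm′-step n k = begin
  mono (k * k + k) ⊗ I ⊗ J            ≈⟨ ⊗-congʳ J (⊗-congʳ I split) ⟩
  M ⊗ Q ⊗ I ⊗ J                       ≈⟨ regroup M Q I J ⟩
  M ⊗ I ⊗ (Q ⊗ J)                     ≈⟨ ⊗-congˡ (M ⊗ I) (invPochSub-recurrence n k) ⟩
  M ⊗ I ⊗ ((Q ⊖ P) ⊗ J′)              ≈⟨ expand M Q I J′ P ⟩
  M ⊗ Q ⊗ I ⊗ J′ ⊖ P ⊗ (M ⊗ I ⊗ J′)  ≈⟨ ⊖-congʳ (P ⊗ (M ⊗ I ⊗ J′)) (⊗-congʳ J′ (⊗-congʳ I (≐-sym split))) ⟩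
  lhsTerm′ (suc n) k ⊖ P ⊗ lhsTerm (suc n) k
                                      ∎
  where
  open ≐-Reasoning
  M Q P I J J′ : FPS
  M  = mono (k * k)
  Q  = mono k
  P  = mono (suc n)
  I  = invPoch k
  J  = invPochSub n k
  J′ = invPochSub (suc n) k
  split : mono (k * k + k) ≐ (M ⊗ Q)
  split = mono-+ (k * k) k
  regroup : ∀ m q i j → (m ⊗ q ⊗ i ⊗ j) ≐ (m ⊗ i ⊗ (q ⊗ j))
  regroup = solve 4 (λ m q i j → m :* q :* i :* j := m :* i :* (q :* j)) ≐-refl
  expand : ∀ m q i j′ p → (m ⊗ i ⊗ ((q ⊖ p) ⊗ j′)) ≐ (m ⊗ q ⊗ i ⊗ j′ ⊖ p ⊗ (m ⊗ i ⊗ j′))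
  expand = solve 5 (λ m q i j′ p → m :* i :* ((q :- p) :* j′)
                                 := m :* q :* i :* j′ :- p :* (m :* i :* j′)) ≐-refl

lhsSum-difference : ∀ n → (1-q^ suc n ⊗ lhsSum (suc n) ⊖ lhsSum n) ≐ (mono (suc n) ⊗ lhsSum′ n)
lhsSum-difference n = begin
  c ⊗ lhsSum (suc n) ⊖ lhsSum n
    ≈⟨ ⊖-congʳ (lhsSum n) (⊗-sumSeries c (summable-lhsTerm (suc n))) ⟩
  sumSeries (λ k → c ⊗ lhsTerm (suc n) k) ⊖ lhsSum n
    ≈⟨ ≐-sym (sumSeries-⊖ (λ k → c ⊗ lhsTerm (suc n) k) (lhsTerm n)) ⟩
  sumSeries D
    ≈⟨ sumSeries-head summable-D ⟩
  D 0 ⊕ sumSeries (λ j → D (suc j))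
    ≈⟨ ⊕-cong (lhsTerm-difference-zero n) (sumSeries-cong (lhsTerm-difference-suc n)) ⟩
  zeroS ⊕ sumSeries (λ j → P ⊗ lhsTerm′ n j)
    ≈⟨ ⊕-congˡ zeroS (≐-sym (⊗-sumSeries P (summable-lhsTerm′ n))) ⟩
  zeroS ⊕ P ⊗ lhsSum′ n
    ≈⟨ ⊕-identityˡ (P ⊗ lhsSum′ n) ⟩
  P ⊗ lhsSum′ n
    ∎
  where
  open ≐-Reasoning
  c P : FPS
  c = 1-q^ suc n
  P = mono (suc n)
  D : ℕ → FPS
  D k = c ⊗ lhsTerm (suc n) k ⊖ lhsTerm n k
  summable-D : Summable D
  summable-D k = q^e∣⊖ (q^e∣⊗ʳ c (summable-lhsTerm (suc n) k)) (summable-lhsTerm n k)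

lhsSum′-step : ∀ n → lhsSum′ n ≐ (lhsSum′ (suc n) ⊖ mono (suc n) ⊗ lhsSum (suc n))
lhsSum′-step n = begin
  lhsSum′ n
    ≈⟨ sumSeries-cong (lhsTerm′-step n) ⟩
  sumSeries (λ k → lhsTerm′ (suc n) k ⊖ mono (suc n) ⊗ lhsTerm (suc n) k)
    ≈⟨ sumSeries-⊖ (lhsTerm′ (suc n)) (λ k → mono (suc n) ⊗ lhsTerm (suc n) k) ⟩
  lhsSum′ (suc n) ⊖ sumSeries (λ k → mono (suc n) ⊗ lhsTerm (suc n) k)
    ≈⟨ ⊖-congˡ (lhsSum′ (suc n)) (≐-sym (⊗-sumSeries (mono (suc n)) (summable-lhsTerm (suc n)))) ⟩
  lhsSum′ (suc n) ⊖ mono (suc n) ⊗ lhsSum (suc n)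
    ∎
  where open ≐-Reasoning

lhs-recurrence : BackwardRecurrence lhs lhs′
lhs-recurrence = BackwardRecurrence-⊗ (inv pochInf) (record
  { first  = λ n → ≐-trans (rearrange (lhsSum n) (1-q^ suc n ⊗ lhsSum (suc n)))
                           (⊖-congˡ (1-q^ suc n ⊗ lhsSum (suc n)) (lhsSum-difference n))
  ; second = lhsSum′-step
  })
  where
  rearrange : ∀ a b → a ≐ (b ⊖ (b ⊖ a))
  rearrange = solve 2 (λ a b → a := b :- (b :- a)) ≐-refl

-- The right-hand side

rhsTerm rhsTerm′ : ℕ → ℕ → FPS
rhsTerm  n k = mono (k * k) ⊗ invPoch k ⊗ invPoch (n + k)
rhsTerm′ n k = mono (k * k + k) ⊗ invPoch k ⊗ invPoch (n + k + 1)

-- Both rhsTerm (suc n) (suc j) − rhsTerm′ n (suc j) and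
-- (rhsTerm′ (suc n) j − rhsTerm′ n j) / q^(n+1) equal this term.
rhsTerm″ : ℕ → ℕ → FPS
rhsTerm″ n j = mono (suc j * suc j) ⊗ invPoch j ⊗ invPoch (suc (suc (n + j)))

rhsSum rhsSum′ rhs rhs′ : ℕ → FPS
rhsSum  n = sumSeries (rhsTerm n)
rhsSum′ n = sumSeries (rhsTerm′ n)
rhs     n = invPoch n ⊗ rhsSum n
rhs′    n = invPoch n ⊗ rhsSum′ n

summable-rhsTerm : ∀ n → Summable (rhsTerm n)
summable-rhsTerm n = summable-term (λ k → k * k) invPoch (λ k → invPoch (n + k)) n≤n*n

summable-rhsTerm′ : ∀ n → Summable (rhsTerm′ n)
summable-rhsTerm′ n =
  summable-term (λ k → k * k + k) invPoch (λ k → invPoch (n + k + 1)) (λ k → ℕ.m≤n+m k (k * k))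

summable-rhsTerm″ : ∀ n → Summable (rhsTerm″ n)
summable-rhsTerm″ n = summable-term (λ k → suc k * suc k) invPoch (λ k → invPoch (suc (suc (n + k))))
                                    (λ k → ℕ.≤-trans (ℕ.n≤1+n k) (n≤n*n (suc k)))

rhsTerm-step : ∀ n k → rhsTerm n k ≐ (rhsTerm (suc n) k ⊖ mono (suc n) ⊗ rhsTerm′ n k)
rhsTerm-step n k = begin
  M ⊗ I ⊗ invPoch (n + k)
    ≈⟨ ⊗-congˡ (M ⊗ I) (invPoch-step (n + k)) ⟩
  M ⊗ I ⊗ (1-q^ suc (n + k) ⊗ Z)
    ≈⟨ expand M I Z (mono (suc (n + k))) ⟩
  M ⊗ I ⊗ Z ⊖ (M ⊗ mono (suc (n + k))) ⊗ I ⊗ Z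
    ≈⟨ ⊖-congˡ (M ⊗ I ⊗ Z) (⊗-cong (⊗-congʳ I (mono-⊗-≡ exponents)) (≡⇒≐ (cong invPoch index))) ⟩
  M ⊗ I ⊗ Z ⊖ (P ⊗ M′) ⊗ I ⊗ Z′
    ≈⟨ ⊖-congˡ (M ⊗ I ⊗ Z) (⊗-assoc₄ P M′ I Z′) ⟩
  rhsTerm (suc n) k ⊖ P ⊗ rhsTerm′ n k
    ∎
  where
  open ≐-Reasoning
  M M′ P I Z Z′ : FPS
  M  = mono (k * k)
  M′ = mono (k * k + k)
  P  = mono (suc n)
  I  = invPoch k
  Z  = invPoch (suc (n + k))
  Z′ = invPoch (n + k + 1)
  exponents : k * k + suc (n + k) ≡ suc n + (k * k + k)
  exponents = ℕ-solve (n ∷ k ∷ [])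
  index : suc (n + k) ≡ n + k + 1
  index = ℕ.+-comm 1 (n + k)
  expand : ∀ m i z r → (m ⊗ i ⊗ ((oneS ⊖ r) ⊗ z)) ≐ (m ⊗ i ⊗ z ⊖ (m ⊗ r) ⊗ i ⊗ z)
  expand = solve 4 (λ m i z r → m :* i :* ((con 1ℤ :- r) :* z) := m :* i :* z :- (m :* r) :* i :* z) ≐-refl

rhsTerm-difference-zero : ∀ n → (rhsTerm (suc n) 0 ⊖ rhsTerm′ n 0) ≐ zeroS
rhsTerm-difference-zero n =
  ≐-trans (⊖-congˡ (rhsTerm (suc n) 0) (⊗-congˡ (oneS ⊗ invPoch 0) (≡⇒≐ (cong invPoch index))))
          (λ m → ℤ.+-inverseʳ (rhsTerm (suc n) 0 m))
  where
  index : n + 0 + 1 ≡ suc n + 0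
  index = ℕ-solve (n ∷ [])

rhsTerm-difference-suc : ∀ n j → (rhsTerm (suc n) (suc j) ⊖ rhsTerm′ n (suc j)) ≐ rhsTerm″ n j
rhsTerm-difference-suc n j = begin
  M ⊗ I′ ⊗ invPoch (suc n + suc j) ⊖ mono (suc j * suc j + suc j) ⊗ I′ ⊗ invPoch (n + suc j + 1)
    ≈⟨ ⊖-cong (⊗-congˡ (M ⊗ I′) (≡⇒≐ (cong invPoch index)))
              (⊗-cong (⊗-congʳ I′ (mono-+ (suc j * suc j) (suc j))) (≡⇒≐ (cong invPoch index′))) ⟩
  M ⊗ I′ ⊗ Y ⊖ M ⊗ Q ⊗ I′ ⊗ Y
    ≈⟨ factor M I′ Y Q ⟩
  M ⊗ (1-q^ suc j ⊗ I′) ⊗ Y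
    ≈⟨ ⊗-congʳ Y (⊗-congˡ M (≐-sym (invPoch-step j))) ⟩
  rhsTerm″ n j
    ∎
  where
  open ≐-Reasoning
  M Q I′ Y : FPS
  M  = mono (suc j * suc j)
  Q  = mono (suc j)
  I′ = invPoch (suc j)
  Y  = invPoch (suc (suc (n + j)))
  index : suc n + suc j ≡ suc (suc (n + j))
  index = ℕ-solve (n ∷ j ∷ [])
  index′ : n + suc j + 1 ≡ suc (suc (n + j))
  index′ = ℕ-solve (n ∷ j ∷ [])
  factor : ∀ m i y q → (m ⊗ i ⊗ y ⊖ m ⊗ q ⊗ i ⊗ y) ≐ (m ⊗ ((oneS ⊖ q) ⊗ i) ⊗ y)
  factor = solve 4 (λ m i y q → m :* i :* y :- m :* q :* i :* y := m :* ((con 1ℤ :- q) :* i) :* y) ≐-refl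

rhsTerm′-difference : ∀ n k → (rhsTerm′ (suc n) k ⊖ rhsTerm′ n k) ≐ (mono (suc n) ⊗ rhsTerm″ n k)
rhsTerm′-difference n k = begin
  M′ ⊗ I ⊗ invPoch (suc n + k + 1) ⊖ M′ ⊗ I ⊗ invPoch (n + k + 1)
    ≈⟨ ⊖-cong (⊗-congˡ (M′ ⊗ I) (≡⇒≐ (cong invPoch index)))
              (⊗-congˡ (M′ ⊗ I) (≐-trans (≡⇒≐ (cong invPoch index′)) (invPoch-step (suc (n + k))))) ⟩
  M′ ⊗ I ⊗ Y ⊖ M′ ⊗ I ⊗ (1-q^ suc (suc (n + k)) ⊗ Y)
    ≈⟨ collect M′ I Y (mono (suc (suc (n + k)))) ⟩
  (M′ ⊗ mono (suc (suc (n + k)))) ⊗ I ⊗ Y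
    ≈⟨ ⊗-congʳ Y (⊗-congʳ I (mono-⊗-≡ exponents)) ⟩
  (P ⊗ mono (suc k * suc k)) ⊗ I ⊗ Y
    ≈⟨ ⊗-assoc₄ P (mono (suc k * suc k)) I Y ⟩
  P ⊗ rhsTerm″ n k
    ∎
  where
  open ≐-Reasoning
  M′ P I Y : FPS
  M′ = mono (k * k + k)
  P  = mono (suc n)
  I  = invPoch k
  Y  = invPoch (suc (suc (n + k)))
  index : suc n + k + 1 ≡ suc (suc (n + k))
  index = ℕ-solve (n ∷ k ∷ [])
  index′ : n + k + 1 ≡ suc (n + k)
  index′ = ℕ-solve (n ∷ k ∷ [])
  exponents : k * k + k + suc (suc (n + k)) ≡ suc n + suc k * suc k
  exponents = ℕ-solve (n ∷ k ∷ [])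
  collect : ∀ m i y s → (m ⊗ i ⊗ y ⊖ m ⊗ i ⊗ ((oneS ⊖ s) ⊗ y)) ≐ ((m ⊗ s) ⊗ i ⊗ y)
  collect = solve 4 (λ m i y s → m :* i :* y :- m :* i :* ((con 1ℤ :- s) :* y) := (m :* s) :* i :* y) ≐-refl

rhsSum-step : ∀ n → rhsSum n ≐ (rhsSum (suc n) ⊖ mono (suc n) ⊗ rhsSum′ n)
rhsSum-step n = begin
  rhsSum n
    ≈⟨ sumSeries-cong (rhsTerm-step n) ⟩
  sumSeries (λ k → rhsTerm (suc n) k ⊖ mono (suc n) ⊗ rhsTerm′ n k)
    ≈⟨ sumSeries-⊖ (rhsTerm (suc n)) (λ k → mono (suc n) ⊗ rhsTerm′ n k) ⟩
  rhsSum (suc n) ⊖ sumSeries (λ k → mono (suc n) ⊗ rhsTerm′ n k)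
    ≈⟨ ⊖-congˡ (rhsSum (suc n)) (≐-sym (⊗-sumSeries (mono (suc n)) (summable-rhsTerm′ n))) ⟩
  rhsSum (suc n) ⊖ mono (suc n) ⊗ rhsSum′ n
    ∎
  where open ≐-Reasoning

rhsSum′-difference : ∀ n → (rhsSum′ (suc n) ⊖ rhsSum′ n) ≐ (mono (suc n) ⊗ (rhsSum (suc n) ⊖ rhsSum′ n))
rhsSum′-difference n = begin
  rhsSum′ (suc n) ⊖ rhsSum′ n                          ≈⟨ ≐-sym (sumSeries-⊖ (rhsTerm′ (suc n)) (rhsTerm′ n)) ⟩
  sumSeries (λ k → rhsTerm′ (suc n) k ⊖ rhsTerm′ n k)  ≈⟨ sumSeries-cong (rhsTerm′-difference n) ⟩
  sumSeries (λ k → P ⊗ rhsTerm″ n k)                   ≈⟨ ≐-sym (⊗-sumSeries P (summable-rhsTerm″ n)) ⟩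
  P ⊗ sumSeries (rhsTerm″ n)                           ≈⟨ ⊗-congˡ P (≐-sym sumSeries-D) ⟩
  P ⊗ sumSeries D                                      ≈⟨ ⊗-congˡ P (sumSeries-⊖ (rhsTerm (suc n)) (rhsTerm′ n)) ⟩
  P ⊗ (rhsSum (suc n) ⊖ rhsSum′ n)                     ∎
  where
  open ≐-Reasoning
  P : FPS
  P = mono (suc n)
  D : ℕ → FPS
  D k = rhsTerm (suc n) k ⊖ rhsTerm′ n k
  sumSeries-D : sumSeries D ≐ sumSeries (rhsTerm″ n)
  sumSeries-D = begin
    sumSeries D                                  ≈⟨ sumSeries-head (λ k → q^e∣⊖ (summable-rhsTerm (suc n) k)
                                                                              (summable-rhsTerm′ n k)) ⟩
    D 0 ⊕ sumSeries (λ j → D (suc j))            ≈⟨ ⊕-cong (rhsTerm-difference-zero n)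
                                                           (sumSeries-cong (rhsTerm-difference-suc n)) ⟩
    zeroS ⊕ sumSeries (rhsTerm″ n)               ≈⟨ ⊕-identityˡ (sumSeries (rhsTerm″ n)) ⟩
    sumSeries (rhsTerm″ n)                       ∎

rhsSum′-step : ∀ n → (1-q^ suc n ⊗ rhsSum′ n) ≐ (rhsSum′ (suc n) ⊖ mono (suc n) ⊗ rhsSum (suc n))
rhsSum′-step n = begin
  (oneS ⊖ P) ⊗ B′                  ≈⟨ expand B′ P B₁ ⟩
  B′ ⊕ P ⊗ (B₁ ⊖ B′) ⊖ P ⊗ B₁      ≈⟨ ⊖-congʳ (P ⊗ B₁) (⊕-congˡ B′ (≐-sym (rhsSum′-difference n))) ⟩
  B′ ⊕ (B′₁ ⊖ B′) ⊖ P ⊗ B₁         ≈⟨ telescope B′ B′₁ (P ⊗ B₁) ⟩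
  B′₁ ⊖ P ⊗ B₁                     ∎
  where
  open ≐-Reasoning
  P B₁ B′ B′₁ : FPS
  P   = mono (suc n)
  B₁  = rhsSum (suc n)
  B′  = rhsSum′ n
  B′₁ = rhsSum′ (suc n)
  expand : ∀ b p b₁ → ((oneS ⊖ p) ⊗ b) ≐ (b ⊕ p ⊗ (b₁ ⊖ b) ⊖ p ⊗ b₁)
  expand = solve 3 (λ b p b₁ → (con 1ℤ :- p) :* b := b :+ p :* (b₁ :- b) :- p :* b₁) ≐-refl
  telescope : ∀ b b₁ x → (b ⊕ (b₁ ⊖ b) ⊖ x) ≐ (b₁ ⊖ x)
  telescope = solve 3 (λ b b₁ x → b :+ (b₁ :- b) :- x := b₁ :- x) ≐-refl

rhs-recurrence : BackwardRecurrence rhs rhs′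
rhs-recurrence = record
  { first  = λ n → begin
      I n ⊗ rhsSum n
        ≈⟨ ⊗-congˡ (I n) (rhsSum-step n) ⟩
      I n ⊗ (rhsSum (suc n) ⊖ P n ⊗ rhsSum′ n)
        ≈⟨ ⊗-distribˡ-⊖-⊗ (I n) (rhsSum (suc n)) (P n) (rhsSum′ n) ⟩
      I n ⊗ rhsSum (suc n) ⊖ P n ⊗ rhs′ n
        ≈⟨ ⊖-congʳ (P n ⊗ rhs′ n) (⊗-congʳ (rhsSum (suc n)) (invPoch-step n)) ⟩
      (c n ⊗ I (suc n)) ⊗ rhsSum (suc n) ⊖ P n ⊗ rhs′ n
        ≈⟨ ⊖-congʳ (P n ⊗ rhs′ n) (⊗-assoc (c n) (I (suc n)) (rhsSum (suc n))) ⟩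
      c n ⊗ rhs (suc n) ⊖ P n ⊗ rhs′ n
        ∎
  ; second = λ n → begin
      I n ⊗ rhsSum′ n
        ≈⟨ ⊗-congʳ (rhsSum′ n) (invPoch-step n) ⟩
      (c n ⊗ I (suc n)) ⊗ rhsSum′ n
        ≈⟨ swap (c n) (I (suc n)) (rhsSum′ n) ⟩
      I (suc n) ⊗ (c n ⊗ rhsSum′ n)
        ≈⟨ ⊗-congˡ (I (suc n)) (rhsSum′-step n) ⟩
      I (suc n) ⊗ (rhsSum′ (suc n) ⊖ P n ⊗ rhsSum (suc n))
        ≈⟨ ⊗-distribˡ-⊖-⊗ (I (suc n)) (rhsSum′ (suc n)) (P n) (rhsSum (suc n)) ⟩
      rhs′ (suc n) ⊖ P n ⊗ rhs (suc n)
        ∎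
  }
  where
  open ≐-Reasoning
  I c P : ℕ → FPS
  I   = invPoch
  c n = 1-q^ suc n
  P n = mono (suc n)
  swap : ∀ c i b → ((c ⊗ i) ⊗ b) ≐ (i ⊗ (c ⊗ b))
  swap = solve 3 (λ c i b → (c :* i) :* b := i :* (c :* b)) ≐-refl

-- Agreement at a single index

limitSeries : (ℕ → ℕ) → FPS
limitSeries e = inv pochInf ⊗ sumSeries (λ k → mono (e k) ⊗ invPoch k ⊗ inv pochInf)

-- For k > N the modulus suc N ∸ k is 0 and the claim is empty; in lhs≡limitSeries the
-- factor q^(e k) makes up for it.
invPochSub≡invPochInf : ∀ N k → invPochSub N k ≡ inv pochInf mod-q^ (suc N ∸ k)
invPochSub≡invPochInf N k = by-cases (k ≤? N)
  where
  by-cases : Dec (k ≤ N) → invPochSub N k ≡ inv pochInf mod-q^ (suc N ∸ k)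
  by-cases (yes k≤N) rewrite ℕ.+-∸-assoc 1 k≤N =
    λ m m<M → trans (invPochSub-≤ k≤N m) (invPoch≡invPochInf (N ∸ k) m m<M)
  by-cases (no k≰N) rewrite ℕ.m≤n⇒m∸n≡0 (ℕ.≰⇒> k≰N) = λ _ ()

lhs≡limitSeries : ∀ N e → (∀ k → k ≤ e k) →
  (inv pochInf ⊗ sumSeries (λ k → mono (e k) ⊗ invPoch k ⊗ invPochSub N k)) ≡ limitSeries e mod-q^ suc N
lhs≡limitSeries N e k≤e = ≡mod-⊗ (≡mod-refl {inv pochInf}) (sumSeries-≡mod term≡)
  where
  term≡ : ∀ k → (mono (e k) ⊗ invPoch k ⊗ invPochSub N k) ≡ (mono (e k) ⊗ invPoch k ⊗ inv pochInf) mod-q^ suc N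
  term≡ k = ≡mod-weaken (suc N) (ℕ.≤-trans (ℕ.m≤n+m∸n (suc N) k) (ℕ.+-monoˡ-≤ (suc N ∸ k) (k≤e k)))
              (q^e∣-⊗-≡mod (q^e∣⊗ˡ (invPoch k) (q^e∣mono (e k) ℕ.≤-refl)) (invPochSub≡invPochInf N k))

rhs≡limitSeries : ∀ N e (j : ℕ → ℕ) → (∀ k → N ≤ j k) →
  (invPoch N ⊗ sumSeries (λ k → mono (e k) ⊗ invPoch k ⊗ invPoch (j k))) ≡ limitSeries e mod-q^ suc N
rhs≡limitSeries N e j N≤j = ≡mod-⊗ (invPoch≡invPochInf N) (sumSeries-≡mod term≡)
  where
  term≡ : ∀ k → (mono (e k) ⊗ invPoch k ⊗ invPoch (j k)) ≡ (mono (e k) ⊗ invPoch k ⊗ inv pochInf) mod-q^ suc N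
  term≡ k = ≡mod-⊗ (≡mod-refl {mono (e k) ⊗ invPoch k})
                   (≡mod-weaken (suc N) (s≤s (N≤j k)) (invPoch≡invPochInf (j k)))

lhs≡rhs-mod-q^1+N : ∀ N → AgreeAt lhs-recurrence rhs-recurrence {suc N} N
lhs≡rhs-mod-q^1+N N =
    ≡mod-trans (lhs≡limitSeries N (λ k → k * k) n≤n*n)
               (≡mod-sym (rhs≡limitSeries N (λ k → k * k) (N +_) (ℕ.m≤m+n N)))
  , ≡mod-trans (lhs≡limitSeries N (λ k → k * k + k) (λ k → ℕ.m≤n+m k (k * k)))
               (≡mod-sym (rhs≡limitSeries N (λ k → k * k + k) (λ k → N + k + 1) N≤N+k+1))
  where
  N≤N+k+1 : ∀ k → N ≤ N + k + 1
  N≤N+k+1 k = ℕ.≤-trans (ℕ.m≤m+n N k) (ℕ.m≤m+n (N + k) 1)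

mainTheorem15 : (n : ℕ) →
    ((inv pochInf ⊗ sumSeries (λ k → mono (k * k) ⊗ inv (poch k) ⊗ invPochSub n k))
      ≐ (inv (poch n) ⊗ sumSeries (λ k → mono (k * k) ⊗ inv (poch k) ⊗ inv (poch (n + k)))))
    × ((inv pochInf ⊗ sumSeries (λ k → mono (k * k + k) ⊗ inv (poch k) ⊗ invPochSub n k))
      ≐ (inv (poch n) ⊗ sumSeries (λ k → mono (k * k + k) ⊗ inv (poch k) ⊗ inv (poch (n + k + 1)))))
mainTheorem15 n = (λ m → proj₁ (agree m) m (m<1+n+m m)) , (λ m → proj₂ (agree m) m (m<1+n+m m))
  where
  agree : ∀ m → AgreeAt lhs-recurrence rhs-recurrence {suc (n + m)} n
  agree m = agreement-descends* lhs-recurrence rhs-recurrence (ℕ.≤⇒≤′ (ℕ.m≤m+n n m))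
                                (lhs≡rhs-mod-q^1+N (n + m))
  m<1+n+m : ∀ m → m < suc (n + m)
  m<1+n+m m = s≤s (ℕ.m≤n+m m n)
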